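{- The intersection of all coherent SDSes equals $\{S\subseteq\mathcal T:S\cap\mathcal T_+\neq\emptyset\}$, and this set is itself the smallest coherent SDS.
   Context: Let $\mathcal T$ be a non-empty set (of "things"), $\mathrm{cl}:\mathcal P(\mathcal T)\to\mathcal P(\mathcal T)$ a closure operator (extensive, monotone, idempotent), $\mathcal T_-\subseteq\mathcal T$ a set of forbidden things, $\mathcal T_+:=\mathrm{cl}(\emptyset)$, with standing assumption $\mathcal T_+\cap\mathcal T_-=\emptyset$. For $\mathcal W\subseteq\mathcal P(\mathcal T)$, $\Sigma_{\mathcal W}$ is the set of maps $\sigma:\mathcal W\to\mathcal T$ with $\sigma(S)\in S$ for all $S\in\mathcal W$, and $\sigma(\mathcal W):=\{\sigma(S):S\in\mathcal W\}$. An SDS is any $K\subseteq\mathcal P(\mathcal T)$. It is coherent if (K1) $\emptyset\notin K$; (K2) if $S_1\in K$ and $S_1\subseteq S_2\subseteq\mathcal T$ then $S_2\in K$; (K3) if $S\in K$ then $S\setminus\mathcal T_-\in K$; (K4) $\{t\}\in K$ for all $t\in\mathcal T_+$; (K5) for every non-empty $\mathcal W\subseteq K$ and every family $(t_\sigma)_{\sigma\in\Sigma_{\mathcal W}}$ with $t_\sigma\in\mathrm{cl}(\sigma(\mathcal W))$, $\{t_\sigma:\sigma\in\Sigma_{\mathcal W}\}\in K$. -}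

module Defs where

open import Level using (0ℓ)
open import Data.Product using (Σ; ∃; _×_; _,_; proj₁)
open import Data.Empty using (⊥)
open import Relation.Nullary using (¬_)
open import Relation.Unary using (Pred; _⊆_; _∈_)
open import Relation.Binary.PropositionalEquality using (_≡_)
open import Function.Bundles using (_⇔_)

Subset : Set → Set₁
Subset T = Pred T 0ℓ

_≐_ : {T : Set} → Subset T → Subset T → Set
A ≐ B = (A ⊆ B) × (B ⊆ A)

∅ : {T : Set} → Subset T
∅ _ = ⊥

-- The standing setting: things, a closure operator, forbidden things,
-- and the assumption T₊ ∩ T₋ = ∅ (with T₊ := cl ∅).
record Setting : Set₁ where
  field
    Thing      : Set
    nonempty   : Thing
    cl         : Subset Thing → Subset Thing
    extensive  : (S : Subset Thing) → S ⊆ cl S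
    monotone   : (S S′ : Subset Thing) → S ⊆ S′ → cl S ⊆ cl S′
    idempotent : (S : Subset Thing) → cl (cl S) ≐ cl S
    Forbidden  : Subset Thing

  T₊ : Subset Thing
  T₊ = cl ∅

  field
    disjoint   : (t : Thing) → t ∈ T₊ → t ∈ Forbidden → ⊥

module _ (C : Setting) where
  open Setting C

  SDS : Set₁
  SDS = Pred (Subset Thing) 0ℓ

  Choice : SDS → Set₁
  Choice W = (S : Subset Thing) → S ∈ W → Σ Thing S

  image : {W : SDS} → Choice W → Thing → Set₁
  image {W} σ t = ∃ λ S → ∃ λ (w : S ∈ W) → proj₁ (σ S w) ≡ t

  Represents : Subset Thing → (Thing → Set₁) → Set₁
  Represents A P = (t : Thing) → (A t → P t) × (P t → A t)

  _∈cl_ : Thing → (Thing → Set₁) → Set₁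
  t ∈cl P = ∃ λ A → Represents A P × t ∈ cl A

  record Coherent (K : SDS) : Set₁ where
    field
      K1 : ¬ (∅ ∈ K)
      K2 : (S₁ S₂ : Subset Thing) → S₁ ∈ K → S₁ ⊆ S₂ → S₂ ∈ K
      K3 : (S : Subset Thing) → S ∈ K → (λ t → S t × ¬ Forbidden t) ∈ K
      K4 : (t : Thing) → t ∈ T₊ → (λ u → u ≡ t) ∈ K
      -- For non-empty W ⊆ K and a family (t_σ) with t_σ ∈ cl(σ(W)),
      -- the set {t_σ : σ ∈ Σ_W} belongs to K.  Since σ(W) and
      -- {t_σ} live one universe level up, they are handled through
      -- extensionally equal level-0 subsets.
      K5 : (W : SDS) → (∃ λ S → S ∈ W) → W ⊆ K →
           (f : Choice W → Thing) → ((σ : Choice W) → f σ ∈cl image σ) →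
           (S : Subset Thing) → Represents S (λ t → ∃ λ σ → f σ ≡ t) →
           S ∈ K

  ⋂Coherent : Subset Thing → Set₁
  ⋂Coherent S = (K : SDS) → Coherent K → S ∈ K

  Meets₊ : SDS
  Meets₊ S = ∃ λ t → S t × T₊ t

{-# OPTIONS --safe #-}
module Submission where

-- Every member of a coherent SDS contains a singleton {t} with t ∈ T₊ by K4
-- and K2, so Meets₊ lies below every coherent SDS. Conversely Meets₊ is
-- coherent: for K5, choose from each S ∈ W a point of S ∩ T₊; the chosen
-- points lie in T₊ = cl ∅, hence so does their closure, and so t_σ for this
-- particular σ witnesses that {t_σ} meets T₊.

open import Defs
open import Data.Product using (_×_; _,_; proj₁; proj₂; ∃)
open import Function using (_∘_)
open import Relation.Unary using (_⊆_; _∈_)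
open import Function.Bundles using (_⇔_; mk⇔)
open import Relation.Binary.PropositionalEquality using (_≡_; refl)

module _ (C : Setting) where
  open Setting C

  cl-⊆T₊ : (A : Subset Thing) → A ⊆ T₊ → cl A ⊆ T₊
  cl-⊆T₊ A A⊆T₊ = proj₁ (idempotent ∅) ∘ monotone A T₊ A⊆T₊

  ∈cl-⊆T₊ : (P : Thing → Set₁) → (∀ t → P t → T₊ t) →
            ∀ {t} → _∈cl_ C t P → T₊ t
  ∈cl-⊆T₊ P P⊆T₊ (A , A≈P , t∈clA) =
    cl-⊆T₊ A (λ {u} u∈A → P⊆T₊ u (proj₁ (A≈P u) u∈A)) t∈clA

  choose₊ : (W : SDS C) → W ⊆ Meets₊ C → Choice C W
  choose₊ W W⊆Meets₊ S S∈W = proj₁ (W⊆Meets₊ S∈W) , proj₁ (proj₂ (W⊆Meets₊ S∈W))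

  image-choose₊⊆T₊ : (W : SDS C) (W⊆Meets₊ : W ⊆ Meets₊ C) →
                     ∀ t → image C (choose₊ W W⊆Meets₊) t → T₊ t
  image-choose₊⊆T₊ W W⊆Meets₊ t (S , S∈W , refl) = proj₂ (proj₂ (W⊆Meets₊ S∈W))

  Meets₊-coherent : Coherent C (Meets₊ C)
  Meets₊-coherent = record
    { K1 = λ { (_ , () , _) }
    ; K2 = λ { S₁ S₂ (t , t∈S₁ , t∈T₊) S₁⊆S₂ → t , S₁⊆S₂ t∈S₁ , t∈T₊ }
    ; K3 = λ { S (t , t∈S , t∈T₊) → t , (t∈S , disjoint t t∈T₊) , t∈T₊ }
    ; K4 = λ t t∈T₊ → t , refl , t∈T₊
    ; K5 = K5
    }
    where
    K5 : (W : SDS C) → (∃ λ S → S ∈ W) → W ⊆ Meets₊ C →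
         (f : Choice C W → Thing) →
         ((σ : Choice C W) → _∈cl_ C (f σ) (image C σ)) →
         (S : Subset Thing) → Represents C S (λ t → ∃ λ σ → f σ ≡ t) →
         S ∈ Meets₊ C
    K5 W _ W⊆Meets₊ f f∈cl S S≈f =
      f σ , proj₂ (S≈f (f σ)) (σ , refl) ,
      ∈cl-⊆T₊ (image C σ) (image-choose₊⊆T₊ W W⊆Meets₊) (f∈cl σ)
      where
      σ : Choice C W
      σ = choose₊ W W⊆Meets₊

  Meets₊⊆coherent : (K : SDS C) → Coherent C K → Meets₊ C ⊆ K
  Meets₊⊆coherent K coh {S} (t , t∈S , t∈T₊) =
    K2 (λ u → u ≡ t) S (K4 t t∈T₊) (λ { refl → t∈S })
    where open Coherent coh

proposition3 : (C : Setting) →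
    ((S : Subset (Setting.Thing C)) → ⋂Coherent C S ⇔ (S ∈ Meets₊ C))
    × Coherent C (Meets₊ C)
    × ((K : SDS C) → Coherent C K → Meets₊ C ⊆ K)
proposition3 C =
  (λ S → mk⇔ (λ S∈⋂ → S∈⋂ (Meets₊ C) (Meets₊-coherent C))
             (λ S∈Meets₊ K coh → Meets₊⊆coherent C K coh S∈Meets₊))
  , Meets₊-coherent C
  , Meets₊⊆coherent C
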